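{- For a finite semidistributive lattice $L$, the canonical complex $\mathrm{CC}(L)$ is a flag simplicial complex, i.e. it is closed under taking subsets, and a subset of $\mathrm{JI}(L)\sqcup\mathrm{MI}(L)$ is a face whenever all its subsets of size at most two are faces.
   Context: $L$ is a finite lattice with join $\vee$, meet $\wedge$. $\mathrm{JI}(L)$ (resp. $\mathrm{MI}(L)$) is the set of elements covering (resp. covered by) exactly one element. A join representation of $x$ is a set $J$ with $\bigvee J=x$, irredundant if no proper subset has join $x$; irredundant join representations are ordered by $J\le J'$ iff each element of $J$ is below some element of $J'$, and the canonical join representation $\mathrm{CJR}(x)$ is the minimum one if it exists. Dually, the canonical meet representation $\mathrm{CMR}(x)$ is the irredundant meet representation $M$ of $x$ such that for every irredundant meet representation $M'$ of $x$ every element of $M$ is above some element of $M'$. $L$ is semidistributive if all elements have both. $\mathrm{CJC}(L)$ is the collection of sets $\mathrm{CJR}(x)$, $x\in L$, and $\mathrm{CMC}(L)$ the collection of sets $\mathrm{CMR}(x)$. The canonical complex $\mathrm{CC}(L)$ has ground set the disjoint union $\mathrm{JI}(L)\sqcup\mathrm{MI}(L)$ (an element both join and meet irreducible appears twice) and faces the disjoint unions $J\sqcup M$ with $J\in\mathrm{CJC}(L)$, $M\in\mathrm{CMC}(L)$ and $\bigvee J\le\bigwedge M$. -}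

module Defs where

open import Level using (0ℓ)
open import Data.Nat using (ℕ; _+_; _≤_)
open import Data.Fin using (Fin)
open import Data.Fin.Subset using (Subset; _∈_; _⊆_; _⊂_; ∣_∣)
open import Data.Product using (_×_; ∃; ∃-syntax; Σ-syntax)
open import Relation.Binary.Core using (Rel)
open import Relation.Binary.PropositionalEquality using (_≡_; _≢_)
open import Relation.Nullary using (¬_)

-- A finite lattice is represented on the carrier Fin n with
-- propositional equality; everything below depends only on the order.
module Canonical {n : ℕ} (_⊑_ : Rel (Fin n) 0ℓ) where

  _⊏_ : Fin n → Fin n → Set
  x ⊏ y = x ⊑ y × x ≢ y

  _⋖_ : Fin n → Fin n → Set
  x ⋖ y = x ⊏ y × (∀ z → ¬ (x ⊏ z × z ⊏ y))

  IsJI : Fin n → Set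
  IsJI x = ∃[ y ] (y ⋖ x × (∀ z → z ⋖ x → z ≡ y))

  IsMI : Fin n → Set
  IsMI x = ∃[ y ] (x ⋖ y × (∀ z → x ⋖ z → z ≡ y))

  IsJoin : Subset n → Fin n → Set
  IsJoin J x = (∀ j → j ∈ J → j ⊑ x) × (∀ y → (∀ j → j ∈ J → j ⊑ y) → x ⊑ y)

  IsMeet : Subset n → Fin n → Set
  IsMeet M x = (∀ m → m ∈ M → x ⊑ m) × (∀ y → (∀ m → m ∈ M → y ⊑ m) → y ⊑ x)

  IrrJoinRep : Fin n → Subset n → Set
  IrrJoinRep x J = IsJoin J x × (∀ J' → J' ⊂ J → ¬ IsJoin J' x)

  IrrMeetRep : Fin n → Subset n → Set
  IrrMeetRep x M = IsMeet M x × (∀ M' → M' ⊂ M → ¬ IsMeet M' x)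

  _≼_ : Subset n → Subset n → Set
  J ≼ J' = ∀ j → j ∈ J → ∃[ j' ] (j' ∈ J' × j ⊑ j')

  IsCJR : Fin n → Subset n → Set
  IsCJR x J = IrrJoinRep x J × (∀ J' → IrrJoinRep x J' → J ≼ J')

  IsCMR : Fin n → Subset n → Set
  IsCMR x M = IrrMeetRep x M
            × (∀ M' → IrrMeetRep x M' → ∀ m → m ∈ M → ∃[ m' ] (m' ∈ M' × m' ⊑ m))

  Semidistributive : Set
  Semidistributive = ∀ x → (∃[ J ] IsCJR x J) × (∃[ M ] IsCMR x M)

  InCJC : Subset n → Set
  InCJC J = ∃[ x ] IsCJR x J

  InCMC : Subset n → Set
  InCMC M = ∃[ x ] IsCMR x M

  -- A subset of JI(L) ⊔ MI(L) is a pair (J , M): J the part in the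
  -- JI copy, M the part in the MI copy.
  InGround : Subset n → Subset n → Set
  InGround J M = (∀ j → j ∈ J → IsJI j) × (∀ m → m ∈ M → IsMI m)

  IsFace : Subset n → Subset n → Set
  IsFace J M = InCJC J × InCMC M
             × ∃[ x ] ∃[ y ] (IsJoin J x × IsMeet M y × x ⊑ y)

  IsFlagComplex : Set
  IsFlagComplex =
      (∀ J M J' M' → IsFace J M → J' ⊆ J → M' ⊆ M → IsFace J' M')
    × (∀ J M → InGround J M
         → (∀ J' M' → J' ⊆ J → M' ⊆ M → ∣ J' ∣ + ∣ M' ∣ ≤ 2 → IsFace J' M')
         → IsFace J M)

-- A subset J' of a canonical join representation J is canonical: replacing J' inside J by any
-- irredundant representation of ⋁J' yields a representation of ⋁J, which J must refine.
-- This gives closure of faces under subsets.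
--
-- For flagness, let A be a set of join-irreducibles all of whose pairs are canonical, and let
-- j ∈ A have lower cover j*. The elements y with j ∧ y = j* are closed under joins by
-- meet-semidistributivity at j*, and j* ∨ j' is one of them for each j' ∈ A - j because {j, j'}
-- is canonical. Hence j ⋢ j* ∨ ⋁(A - j), which makes A irredundant and forces every j ∈ A into
-- the canonical join representation of ⋁A. The dual argument handles M, and the faces {j} ⊔ {m}
-- give ⋁J ⊑ ⋀M.

module Submission where

open import Defs
open import Level using (0ℓ)
open import Algebra.Core using (Op₂)
open import Data.Bool using (true; false)
open import Data.Empty using (⊥-elim)
open import Data.Fin using (Fin; zero; suc; _≟_)
open import Data.Fin.Induction using (po-noetherian)
open import Data.Fin.Properties using (any?; all?)
open import Data.Fin.Subset using (Subset; _∈_; _∉_; _⊆_; _⊂_; ∣_∣; _∪_; _─_; _∩_; ∁; _-_; ⁅_⁆)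
  renaming (⊥ to ∅)
open import Data.Fin.Subset.Induction using (⊂-wellFounded)
open import Data.Fin.Subset.Properties
  using (_∈?_; drop-there; ⊆-refl; ⊆-trans; ⊥⊆; ∣⊥∣≡0; ∣⁅x⁆∣≡1; x∈⁅x⁆; x∈⁅y⁆⇒x≡y;
         p⊆p∪q; q⊆p∪q; x∈p∪q⁻;
         x∈p∩q⁺; x∈p∩q⁻; p∩q⊆p; x∉p⇒x∈∁p; x∈∁p⇒x∉p;
         p─q⊆p; x∈p∧x≢y⇒x∈p-y; x∈p⇒p-x⊂p)
open import Data.List using (List; []; _∷_; foldr; filter; map; allFin)
open import Data.List.Membership.Propositional using () renaming (_∈_ to _∈ₗ_)
open import Data.List.Membership.Propositional.Properties
  using (∈-filter⁺; ∈-filter⁻; ∈-allFin; ∈-map⁺; ∈-map⁻)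
open import Data.List.Relation.Unary.Any using (here; there)
open import Data.Nat using (ℕ; _+_; _≤_; z≤n; s≤s)
open import Data.Nat.Properties using (+-suc; +-identityʳ; n≤1+n; +-monoʳ-≤; ≤-reflexive)
  renaming (≤-trans to ℕ≤-trans)
open import Data.Product using (_×_; _,_; proj₁; proj₂; ∃; ∃-syntax; swap)
open import Data.Sum using (_⊎_; inj₁; inj₂)
open import Data.Vec using ([]; _∷_)
open import Function using (flip; _∘_)
open import Induction.WellFounded using (Acc; acc)
open import Relation.Binary.Core using (Rel)
open import Relation.Binary.Definitions using (Decidable)
open import Relation.Binary.Lattice.Bundles using (Lattice)
open import Relation.Binary.Lattice.Structures using (IsLattice)
import Relation.Binary.Lattice.Properties.JoinSemilattice as JoinSemilatticeProperties
import Relation.Binary.Lattice.Properties.Lattice as LatticeProperties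
open import Relation.Binary.PropositionalEquality using (_≡_; _≢_; refl; sym; subst; cong₂)
open import Relation.Nullary using (¬_; Dec; yes; no; ¬?)
open import Relation.Nullary.Decidable using (_×-dec_; _→-dec_)

x∈p─q⇒x∉q : ∀ {n} (p q : Subset n) {x} → x ∈ p ─ q → x ∉ q
x∈p─q⇒x∉q (_ ∷ p) (true  ∷ q) {zero}  () _
x∈p─q⇒x∉q (_ ∷ p) (false ∷ q) {zero}  _  ()
x∈p─q⇒x∉q (_ ∷ p) (_     ∷ q) {suc x} x∈p─q x∈q = x∈p─q⇒x∉q p q (drop-there x∈p─q) (drop-there x∈q)

∣p∪q∣≤∣p∣+∣q∣ : ∀ {n} (p q : Subset n) → ∣ p ∪ q ∣ ≤ ∣ p ∣ + ∣ q ∣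
∣p∪q∣≤∣p∣+∣q∣ []          []          = z≤n
∣p∪q∣≤∣p∣+∣q∣ (true  ∷ p) (true  ∷ q) =
  s≤s (ℕ≤-trans (∣p∪q∣≤∣p∣+∣q∣ p q) (+-monoʳ-≤ ∣ p ∣ (n≤1+n ∣ q ∣)))
∣p∪q∣≤∣p∣+∣q∣ (true  ∷ p) (false ∷ q) = s≤s (∣p∪q∣≤∣p∣+∣q∣ p q)
∣p∪q∣≤∣p∣+∣q∣ (false ∷ p) (true  ∷ q) =
  ℕ≤-trans (s≤s (∣p∪q∣≤∣p∣+∣q∣ p q)) (≤-reflexive (sym (+-suc ∣ p ∣ ∣ q ∣)))
∣p∪q∣≤∣p∣+∣q∣ (false ∷ p) (false ∷ q) = ∣p∪q∣≤∣p∣+∣q∣ p q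

module _ {n : ℕ} where

  x∈⁅y⁆∪⁅z⁆⇒x≡y⊎x≡z : ∀ {x y z : Fin n} → x ∈ ⁅ y ⁆ ∪ ⁅ z ⁆ → x ≡ y ⊎ x ≡ z
  x∈⁅y⁆∪⁅z⁆⇒x≡y⊎x≡z {y = y} {z} x∈ with x∈p∪q⁻ ⁅ y ⁆ ⁅ z ⁆ x∈
  ... | inj₁ x∈⁅y⁆ = inj₁ (x∈⁅y⁆⇒x≡y y x∈⁅y⁆)
  ... | inj₂ x∈⁅z⁆ = inj₂ (x∈⁅y⁆⇒x≡y z x∈⁅z⁆)

  y∈⁅y⁆∪⁅z⁆ : ∀ (y z : Fin n) → y ∈ ⁅ y ⁆ ∪ ⁅ z ⁆
  y∈⁅y⁆∪⁅z⁆ y z = p⊆p∪q ⁅ z ⁆ (x∈⁅x⁆ y)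

  z∈⁅y⁆∪⁅z⁆ : ∀ (y z : Fin n) → z ∈ ⁅ y ⁆ ∪ ⁅ z ⁆
  z∈⁅y⁆∪⁅z⁆ y z = q⊆p∪q ⁅ y ⁆ ⁅ z ⁆ (x∈⁅x⁆ z)

  ⁅x⁆⊆p : ∀ {x} {p : Subset n} → x ∈ p → ⁅ x ⁆ ⊆ p
  ⁅x⁆⊆p {x} x∈p y∈⁅x⁆ = subst (_∈ _) (sym (x∈⁅y⁆⇒x≡y x y∈⁅x⁆)) x∈p

  ⁅y⁆∪⁅z⁆⊆p : ∀ {y z} {p : Subset n} → y ∈ p → z ∈ p → ⁅ y ⁆ ∪ ⁅ z ⁆ ⊆ p
  ⁅y⁆∪⁅z⁆⊆p y∈p z∈p x∈ with x∈⁅y⁆∪⁅z⁆⇒x≡y⊎x≡z x∈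
  ... | inj₁ refl = y∈p
  ... | inj₂ refl = z∈p

  x∈p-y⇒x∈p×x≢y : ∀ {p : Subset n} {x y} → x ∈ p - y → x ∈ p × x ≢ y
  x∈p-y⇒x∈p×x≢y {p} {y = y} x∈p-y =
    p─q⊆p p ⁅ y ⁆ x∈p-y , λ { refl → x∈p─q⇒x∉q p ⁅ y ⁆ x∈p-y (x∈⁅x⁆ y) }

  ∣p∣+∣∅∣≤2 : ∀ (p : Subset n) → ∣ p ∣ ≤ 2 → ∣ p ∣ + ∣ ∅ {n} ∣ ≤ 2
  ∣p∣+∣∅∣≤2 p ∣p∣≤2 rewrite ∣⊥∣≡0 n | +-identityʳ ∣ p ∣ = ∣p∣≤2

  ∣∅∣+∣p∣≤2 : ∀ (p : Subset n) → ∣ p ∣ ≤ 2 → ∣ ∅ {n} ∣ + ∣ p ∣ ≤ 2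
  ∣∅∣+∣p∣≤2 _ ∣p∣≤2 rewrite ∣⊥∣≡0 n = ∣p∣≤2

  ∣∅∣+∣∅∣≤2 : ∣ ∅ {n} ∣ + ∣ ∅ {n} ∣ ≤ 2
  ∣∅∣+∣∅∣≤2 rewrite ∣⊥∣≡0 n = z≤n

  ∣⁅x⁆∣+∣⁅y⁆∣≤2 : ∀ (x y : Fin n) → ∣ ⁅ x ⁆ ∣ + ∣ ⁅ y ⁆ ∣ ≤ 2
  ∣⁅x⁆∣+∣⁅y⁆∣≤2 x y = ≤-reflexive (cong₂ _+_ (∣⁅x⁆∣≡1 x) (∣⁅x⁆∣≡1 y))

  ∣⁅x⁆∪⁅y⁆∣≤2 : ∀ (x y : Fin n) → ∣ ⁅ x ⁆ ∪ ⁅ y ⁆ ∣ ≤ 2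
  ∣⁅x⁆∪⁅y⁆∣≤2 x y = ℕ≤-trans (∣p∪q∣≤∣p∣+∣q∣ ⁅ x ⁆ ⁅ y ⁆) (∣⁅x⁆∣+∣⁅y⁆∣≤2 x y)

module JoinRepresentations {n : ℕ} {_⊑_ : Rel (Fin n) 0ℓ} {_∨_ _∧_ : Op₂ (Fin n)}
  (isLattice : IsLattice _≡_ _⊑_ _∨_ _∧_) where

  open IsLattice isLattice
    using (isPartialOrder; x≤x∨y; y≤x∨y; ∨-least; x∧y≤x; x∧y≤y)
    renaming (refl to ⊑-refl; trans to ⊑-trans; antisym to ⊑-antisym)
  open Canonical _⊑_

  lattice : Lattice 0ℓ 0ℓ 0ℓ
  lattice = record { isLattice = isLattice }

  open LatticeProperties lattice public using (∧-∨-isLattice)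
  open JoinSemilatticeProperties (Lattice.joinSemilattice lattice) using (≈-dec⇒≤-dec)

  UpperBound : Subset n → Fin n → Set
  UpperBound S y = ∀ j → j ∈ S → j ⊑ y

  _⊑?_ : Decidable _⊑_
  _⊑?_ = ≈-dec⇒≤-dec _≟_

  _⊏?_ : Decidable _⊏_
  x ⊏? y = x ⊑? y ×-dec ¬? (x ≟ y)

  upperBound? : ∀ S y → Dec (UpperBound S y)
  upperBound? S y = all? (λ j → j ∈? S →-dec j ⊑? y)

  IsJoin? : ∀ S x → Dec (IsJoin S x)
  IsJoin? S x = upperBound? S x ×-dec all? (λ y → upperBound? S y →-dec x ⊑? y)

  IsJoin-unique : ∀ {S x y} → IsJoin S x → IsJoin S y → x ≡ y
  IsJoin-unique (x-upper , x-least) (y-upper , y-least) =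
    ⊑-antisym (x-least _ y-upper) (y-least _ x-upper)

  UpperBound-pair : ∀ {a b y} → a ⊑ y → b ⊑ y → UpperBound (⁅ a ⁆ ∪ ⁅ b ⁆) y
  UpperBound-pair a⊑y b⊑y _ i∈ with x∈⁅y⁆∪⁅z⁆⇒x≡y⊎x≡z i∈
  ... | inj₁ refl = a⊑y
  ... | inj₂ refl = b⊑y

  IsJoin-pair : ∀ x y → IsJoin (⁅ x ⁆ ∪ ⁅ y ⁆) (x ∨ y)
  IsJoin-pair x y = UpperBound-pair (x≤x∨y x y) (y≤x∨y x y)
                  , λ z z-upper → ∨-least (z-upper x (y∈⁅y⁆∪⁅z⁆ x y)) (z-upper y (z∈⁅y⁆∪⁅z⁆ x y))

  IsJoin-≼ : ∀ {T S x} → T ≼ S → UpperBound S x → IsJoin T x → IsJoin S x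
  IsJoin-≼ T≼S S-upper (_ , T-least) = S-upper , λ y y-upper → T-least y λ t t∈T →
    let s , s∈S , t⊑s = T≼S t t∈T in ⊑-trans t⊑s (y-upper s s∈S)

  ⊆⇒≼ : ∀ {S T} → S ⊆ T → S ≼ T
  ⊆⇒≼ S⊆T s s∈S = s , S⊆T s∈S , ⊑-refl

  IsJoin-between : ∀ {K S J x} → K ⊆ S → S ⊆ J → IsJoin K x → IsJoin J x → IsJoin S x
  IsJoin-between K⊆S S⊆J K↦x (J-upper , _) = IsJoin-≼ (⊆⇒≼ K⊆S) (λ s → J-upper s ∘ S⊆J) K↦x

  IsJoin-remove : ∀ {J x j k} → j ⊑ k → k ∈ J - j → IsJoin J x → IsJoin (J - j) x
  IsJoin-remove {J} {j = j} {k} j⊑k k∈J-j J↦x@(J-upper , _) =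
    IsJoin-≼ J≼J-j (λ i → J-upper i ∘ p─q⊆p J ⁅ j ⁆) J↦x
    where
    J≼J-j : J ≼ (J - j)
    J≼J-j i i∈J with i ≟ j
    ... | yes refl = k , k∈J-j , j⊑k
    ... | no i≢j   = i , x∈p∧x≢y⇒x∈p-y i∈J i≢j , ⊑-refl

  IrrJoinRep-byRemoval : ∀ {J x} → IsJoin J x → (∀ s → s ∈ J → ¬ IsJoin (J - s) x) → IrrJoinRep x J
  IrrJoinRep-byRemoval {J} J↦x irremovable = J↦x , λ where
    J' (J'⊆J , s , s∈J , s∉J') J'↦x →
      irremovable s s∈J (IsJoin-between (λ i∈J' → x∈p∧x≢y⇒x∈p-y (J'⊆J i∈J') λ { refl → s∉J' i∈J' })
                                        (p─q⊆p J ⁅ s ⁆) J'↦x J↦x)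

  ∃IrrJoinRep⊆ : ∀ {S x} → IsJoin S x → ∃[ K ] (K ⊆ S × IrrJoinRep x K)
  ∃IrrJoinRep⊆ {S} {x} = go (⊂-wellFounded S)
    where
    go : ∀ {S} → Acc _⊂_ S → IsJoin S x → ∃[ K ] (K ⊆ S × IrrJoinRep x K)
    go {S} (acc smaller) S↦x with any? (λ s → s ∈? S ×-dec IsJoin? (S - s) x)
    ... | yes (s , s∈S , S-s↦x) =
      let K , K⊆S-s , K-irr = go (smaller (x∈p⇒p-x⊂p s∈S)) S-s↦x
      in K , ⊆-trans K⊆S-s (p─q⊆p S ⁅ s ⁆) , K-irr
    ... | no ∄removable =
      S , ⊆-refl , IrrJoinRep-byRemoval S↦x λ s s∈S S-s↦x → ∄removable (s , s∈S , S-s↦x)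

  IrrJoinRep-antichain : ∀ {J x j k} → IrrJoinRep x J → j ∈ J → k ∈ J → j ⊑ k → j ≡ k
  IrrJoinRep-antichain {J} {j = j} {k} (J↦x , irr) j∈J k∈J j⊑k with j ≟ k
  ... | yes j≡k = j≡k
  ... | no j≢k  = ⊥-elim (irr (J - j) (x∈p⇒p-x⊂p j∈J)
                       (IsJoin-remove j⊑k (x∈p∧x≢y⇒x∈p-y k∈J (j≢k ∘ sym)) J↦x))

  IsJoin-replace : ∀ {J J' K x y} → J' ⊆ J → IsJoin J x → IsJoin J' y → IsJoin K y →
                   IsJoin (K ∪ (J ∩ ∁ J')) x
  IsJoin-replace {J} {J'} {K} {x} {y} J'⊆J (J-upper , J-least) (J'-upper , J'-least) (K-upper , K-least)
    = upper , least
    where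
    y⊑x : y ⊑ x
    y⊑x = J'-least x λ j → J-upper j ∘ J'⊆J

    upper : UpperBound (K ∪ (J ∩ ∁ J')) x
    upper i i∈ with x∈p∪q⁻ K (J ∩ ∁ J') i∈
    ... | inj₁ i∈K  = ⊑-trans (K-upper i i∈K) y⊑x
    ... | inj₂ i∈J∖ = J-upper i (p∩q⊆p J (∁ J') i∈J∖)

    least : ∀ z → UpperBound (K ∪ (J ∩ ∁ J')) z → x ⊑ z
    least z z-upper = J-least z λ i i∈J → case i i∈J (i ∈? J')
      where
      case : ∀ i → i ∈ J → Dec (i ∈ J') → i ⊑ z
      case i _ (yes i∈J') = ⊑-trans (J'-upper i i∈J') (K-least z λ k → z-upper k ∘ p⊆p∪q (J ∩ ∁ J'))
      case i i∈J (no i∉J') = z-upper i (q⊆p∪q K (J ∩ ∁ J') (x∈p∩q⁺ (i∈J , x∉p⇒x∈∁p i∉J')))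

  IsCJR-⊆ : ∀ {J J' x y} → IsCJR x J → J' ⊆ J → IsJoin J' y → IsCJR y J'
  IsCJR-⊆ {J} {J'} {x} {y} ((J↦x , J-irr) , J-min) J'⊆J J'↦y = (J'↦y , J'-irr) , J'-min
    where
    J'-irr : ∀ J'' → J'' ⊂ J' → ¬ IsJoin J'' y
    J'-irr J'' (J''⊆J' , s , s∈J' , s∉J'') J''↦y =
      J-irr (J'' ∪ (J ∩ ∁ J')) (⊆J , s , J'⊆J s∈J' , s∉) (IsJoin-replace J'⊆J J↦x J'↦y J''↦y)
      where
      ⊆J : J'' ∪ (J ∩ ∁ J') ⊆ J
      ⊆J i∈ with x∈p∪q⁻ J'' (J ∩ ∁ J') i∈
      ... | inj₁ i∈J'' = J'⊆J (J''⊆J' i∈J'')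
      ... | inj₂ i∈J∖J' = p∩q⊆p J (∁ J') i∈J∖J'

      s∉ : s ∉ J'' ∪ (J ∩ ∁ J')
      s∉ s∈ with x∈p∪q⁻ J'' (J ∩ ∁ J') s∈
      ... | inj₁ s∈J'' = s∉J'' s∈J''
      ... | inj₂ s∈J∖J' = x∈∁p⇒x∉p (proj₂ (x∈p∩q⁻ J (∁ J') s∈J∖J')) s∈J'

    J'-min : ∀ K → IrrJoinRep y K → J' ≼ K
    J'-min K (K↦y , _) j j∈J' with ∃IrrJoinRep⊆ (IsJoin-replace J'⊆J J↦x J'↦y K↦y)
    ... | K₀ , K₀⊆ , K₀-irr with J-min K₀ K₀-irr j (J'⊆J j∈J')
    ...   | k , k∈K₀ , j⊑k with x∈p∪q⁻ K (J ∩ ∁ J') (K₀⊆ k∈K₀)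
    ...     | inj₁ k∈K    = k , k∈K , j⊑k
    ...     | inj₂ k∈J∖J' = ⊥-elim (x∈∁p⇒x∉p k∈∁J' (subst (_∈ J') j≡k j∈J'))
      where
      k∈J   = proj₁ (x∈p∩q⁻ J (∁ J') k∈J∖J')
      k∈∁J' = proj₂ (x∈p∩q⁻ J (∁ J') k∈J∖J')
      j≡k   = IrrJoinRep-antichain (J↦x , J-irr) (J'⊆J j∈J') k∈J j⊑k

  joinFrom : Fin n → List (Fin n) → Fin n
  joinFrom = foldr _∨_

  joinFrom-base : ∀ z xs → z ⊑ joinFrom z xs
  joinFrom-base z []       = ⊑-refl
  joinFrom-base z (x ∷ xs) = ⊑-trans (joinFrom-base z xs) (y≤x∨y x _)

  joinFrom-upper : ∀ z {xs x} → x ∈ₗ xs → x ⊑ joinFrom z xs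
  joinFrom-upper z {x ∷ xs} (here refl) = x≤x∨y x _
  joinFrom-upper z {y ∷ xs} (there x∈) = ⊑-trans (joinFrom-upper z x∈) (y≤x∨y y _)

  joinFrom-least : ∀ {z y} xs → z ⊑ y → (∀ {x} → x ∈ₗ xs → x ⊑ y) → joinFrom z xs ⊑ y
  joinFrom-least []       z⊑y _    = z⊑y
  joinFrom-least (x ∷ xs) z⊑y xs⊑y =
    ∨-least (xs⊑y (here refl)) (joinFrom-least xs z⊑y (xs⊑y ∘ there))

  joinFrom-closed : (P : Fin n → Set) → (∀ {a b} → P a → P b → P (a ∨ b)) →
                    ∀ {z} xs → P z → (∀ {x} → x ∈ₗ xs → P x) → P (joinFrom z xs)
  joinFrom-closed P ∨-closed []       Pz _   = Pz
  joinFrom-closed P ∨-closed (x ∷ xs) Pz Pxs =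
    ∨-closed (Pxs (here refl)) (joinFrom-closed P ∨-closed xs Pz (Pxs ∘ there))

  members : Subset n → List (Fin n)
  members S = filter (_∈? S) (allFin n)

  ∈-members⁺ : ∀ {S x} → x ∈ S → x ∈ₗ members S
  ∈-members⁺ {S} {x} = ∈-filter⁺ (_∈? S) (∈-allFin x)

  ∈-members⁻ : ∀ {S x} → x ∈ₗ members S → x ∈ S
  ∈-members⁻ {S} = proj₂ ∘ ∈-filter⁻ (_∈? S) {xs = allFin n}

  foldr-∧-lower : ∀ z {xs x} → x ∈ₗ xs → foldr _∧_ z xs ⊑ x
  foldr-∧-lower z {x ∷ xs} (here refl) = x∧y≤x x _
  foldr-∧-lower z {y ∷ xs} (there x∈) = ⊑-trans (x∧y≤y y _) (foldr-∧-lower z x∈)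

  -- The carrier is empty when n = 0, so an element is needed to start the fold.
  bottom : Fin n → Fin n
  bottom e = foldr _∧_ e (allFin n)

  bottom-least : ∀ e y → bottom e ⊑ y
  bottom-least e y = foldr-∧-lower e (∈-allFin y)

  ∃IsJoin : Fin n → ∀ S → ∃ (IsJoin S)
  ∃IsJoin e S = joinFrom (bottom e) (members S)
              , (λ j → joinFrom-upper _ ∘ ∈-members⁺)
              , λ y y-upper → joinFrom-least _ (bottom-least e y) (y-upper _ ∘ ∈-members⁻)

  ⊏⇒∃⋖ : ∀ {c j} → c ⊏ j → ∃[ z ] (c ⊑ z × z ⋖ j)
  ⊏⇒∃⋖ {c} {j} = go (po-noetherian isPartialOrder c)
    where
    go : ∀ {c} → Acc (flip _⊏_) c → c ⊏ j → ∃[ z ] (c ⊑ z × z ⋖ j)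
    go {c} (acc above) c⊏j with any? (λ w → c ⊏? w ×-dec w ⊏? j)
    ... | yes (w , c⊏w , w⊏j) =
      let z , w⊑z , z⋖j = go (above c⊏w) w⊏j in z , ⊑-trans (proj₁ c⊏w) w⊑z , z⋖j
    ... | no ∄between = c , ⊑-refl , c⊏j , λ w c⊏w⊏j → ∄between (w , c⊏w⊏j)

module _ {n : ℕ} {_⊑_ : Rel (Fin n) 0ℓ} where
  private
    module L   = Canonical _⊑_
    module Lᵒᵖ = Canonical (flip _⊑_)

  ⋖⇒⋖ᵒᵖ : ∀ {x y} → x L.⋖ y → y Lᵒᵖ.⋖ x
  ⋖⇒⋖ᵒᵖ ((x⊑y , x≢y) , nothing-between) =
    (x⊑y , x≢y ∘ sym) , λ z ((z⊑y , y≢z) , (x⊑z , z≢x)) →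
      nothing-between z ((x⊑z , z≢x ∘ sym) , (z⊑y , y≢z ∘ sym))

  Semidistributive⇒Semidistributiveᵒᵖ : L.Semidistributive → Lᵒᵖ.Semidistributive
  Semidistributive⇒Semidistributiveᵒᵖ sd = swap ∘ sd

module _ {n : ℕ} {_⊑_ : Rel (Fin n) 0ℓ} where

  IsMI⇒IsJIᵒᵖ : ∀ {x} → Canonical.IsMI _⊑_ x → Canonical.IsJI (flip _⊑_) x
  IsMI⇒IsJIᵒᵖ (y , x⋖y , unique) =
    y , ⋖⇒⋖ᵒᵖ x⋖y , λ z z⋖ᵒᵖx → unique z (⋖⇒⋖ᵒᵖ {_⊑_ = flip _⊑_} z⋖ᵒᵖx)

module SemidistributiveLattice {n : ℕ} {_⊑_ : Rel (Fin n) 0ℓ} {_∨_ _∧_ : Op₂ (Fin n)}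
  (isLattice : IsLattice _≡_ _⊑_ _∨_ _∧_) (sd : Canonical.Semidistributive _⊑_) where

  open IsLattice isLattice
    using (x≤x∨y; y≤x∨y; ∨-least; x∧y≤x; x∧y≤y; ∧-greatest)
    renaming (refl to ⊑-refl; trans to ⊑-trans; antisym to ⊑-antisym)
  open Canonical _⊑_
  open JoinRepresentations isLattice
  private module Meet = JoinRepresentations ∧-∨-isLattice

  module JoinIrreducible {j : Fin n} (j-ji : IsJI j) where

    j* : Fin n
    j* = proj₁ j-ji

    j*⊑j : j* ⊑ j
    j*⊑j = proj₁ (proj₁ (proj₁ (proj₂ j-ji)))

    j⋢j* : ¬ j ⊑ j*
    j⋢j* j⊑j* = proj₂ (proj₁ (proj₁ (proj₂ j-ji))) (⊑-antisym j*⊑j j⊑j*)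

    ⊏⇒⊑j* : ∀ {c} → c ⊏ j → c ⊑ j*
    ⊏⇒⊑j* {c} c⊏j = let z , c⊑z , z⋖j = ⊏⇒∃⋖ c⊏j in subst (c ⊑_) (proj₂ (proj₂ j-ji) z z⋖j) c⊑z

    -- Equivalently j ∧ y = j*; closure under ∨ is where meet-semidistributivity enters.
    Avoids : Fin n → Set
    Avoids y = j* ⊑ y × ¬ j ⊑ y

    j*-avoids : Avoids j*
    j*-avoids = ⊑-refl , j⋢j*

    avoids⇒j∧y≡j* : ∀ {y} → Avoids y → j ∧ y ≡ j*
    avoids⇒j∧y≡j* {y} (j*⊑y , j⋢y) =
      ⊑-antisym (⊏⇒⊑j* (x∧y≤x j y , λ j∧y≡j → j⋢y (subst (_⊑ y) j∧y≡j (x∧y≤y j y))))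
                (∧-greatest j*⊑j j*⊑y)

    avoids⇒CMR-above : ∀ {y C} → Avoids y → IsCMR j* C → ∀ c → c ∈ C → j ⊑ c ⊎ y ⊑ c
    avoids⇒CMR-above {y} y-avoids (_ , C-min) c c∈C with Meet.∃IrrJoinRep⊆ pair↦j*
      where
      pair↦j* : IsMeet (⁅ j ⁆ ∪ ⁅ y ⁆) j*
      pair↦j* = subst (IsMeet _) (avoids⇒j∧y≡j* y-avoids) (Meet.IsJoin-pair j y)
    ... | K , K⊆pair , K-irr with C-min K K-irr c c∈C
    ...   | k , k∈K , k⊑c with x∈⁅y⁆∪⁅z⁆⇒x≡y⊎x≡z (K⊆pair k∈K)
    ...     | inj₁ refl = inj₁ k⊑c
    ...     | inj₂ refl = inj₂ k⊑c

    avoids-∨ : ∀ {y₁ y₂} → Avoids y₁ → Avoids y₂ → Avoids (y₁ ∨ y₂)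
    avoids-∨ {y₁} {y₂} y₁-avoids y₂-avoids = ⊑-trans (proj₁ y₁-avoids) (x≤x∨y y₁ y₂) , j⋢y₁∨y₂
      where
      C-cmr = proj₂ (proj₂ (sd j*))

      j⋢y₁∨y₂ : ¬ j ⊑ (y₁ ∨ y₂)
      j⋢y₁∨y₂ j⊑y₁∨y₂ = j⋢j* (proj₂ (proj₁ (proj₁ C-cmr)) j λ c c∈C →
        above (avoids⇒CMR-above y₁-avoids C-cmr c c∈C) (avoids⇒CMR-above y₂-avoids C-cmr c c∈C))
        where
        above : ∀ {c} → j ⊑ c ⊎ y₁ ⊑ c → j ⊑ c ⊎ y₂ ⊑ c → j ⊑ c
        above (inj₁ j⊑c)  _           = j⊑c
        above (inj₂ _)    (inj₁ j⊑c)  = j⊑c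
        above (inj₂ y₁⊑c) (inj₂ y₂⊑c) = ⊑-trans j⊑y₁∨y₂ (∨-least y₁⊑c y₂⊑c)

    InCJC-pair⇒avoids : ∀ {j'} → j ≢ j' → InCJC (⁅ j ⁆ ∪ ⁅ j' ⁆) → Avoids (j* ∨ j')
    InCJC-pair⇒avoids {j'} j≢j' (w , (P↦w , P-irr) , P-min) = x≤x∨y j* j' , j⋢j*∨j'
      where
      j∈P  = y∈⁅y⁆∪⁅z⁆ j j'
      j'∈P = z∈⁅y⁆∪⁅z⁆ j j'

      T≼P : (⁅ j* ⁆ ∪ ⁅ j' ⁆) ≼ (⁅ j ⁆ ∪ ⁅ j' ⁆)
      T≼P t t∈T with x∈⁅y⁆∪⁅z⁆⇒x≡y⊎x≡z t∈T
      ... | inj₁ refl = j , j∈P , j*⊑j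
      ... | inj₂ refl = j' , j'∈P , ⊑-refl

      T↦w : j ⊑ (j* ∨ j') → IsJoin (⁅ j* ⁆ ∪ ⁅ j' ⁆) w
      T↦w j⊑j*∨j' = subst (IsJoin _) (IsJoin-unique P↦j*∨j' P↦w) (IsJoin-pair j* j')
        where
        P↦j*∨j' = IsJoin-≼ T≼P (UpperBound-pair j⊑j*∨j' (y≤x∨y j* j')) (IsJoin-pair j* j')

      j⋢j*∨j' : ¬ j ⊑ (j* ∨ j')
      j⋢j*∨j' j⊑j*∨j' with ∃IrrJoinRep⊆ (T↦w j⊑j*∨j')
      ... | K , K⊆T , K-irr with P-min K K-irr j j∈P
      ...   | k , k∈K , j⊑k with x∈⁅y⁆∪⁅z⁆⇒x≡y⊎x≡z (K⊆T k∈K)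
      ...     | inj₁ refl = j⋢j* j⊑k
      ...     | inj₂ refl = j≢j' (IrrJoinRep-antichain (P↦w , P-irr) j∈P j'∈P j⊑k)

  PairwiseCanonical : Subset n → Set
  PairwiseCanonical A = ∀ j j' → j ∈ A → j' ∈ A → j ≢ j' → InCJC (⁅ j ⁆ ∪ ⁅ j' ⁆)

  module _ {A : Subset n} (A-ji : ∀ j → j ∈ A → IsJI j) (A-pairs : PairwiseCanonical A) where

    module Escape {j : Fin n} (j∈A : j ∈ A) where
      open JoinIrreducible (A-ji j j∈A) public

      escape : Fin n
      escape = joinFrom j* (map (j* ∨_) (members (A - j)))

      escape-avoids : Avoids escape
      escape-avoids = joinFrom-closed Avoids avoids-∨ _ j*-avoids pairs-avoid
        where
        pairs-avoid : ∀ {x} → x ∈ₗ map (j* ∨_) (members (A - j)) → Avoids x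
        pairs-avoid x∈ with ∈-map⁻ (j* ∨_) x∈
        ... | a , a∈ , refl =
          let a∈A , a≢j = x∈p-y⇒x∈p×x≢y (∈-members⁻ a∈)
          in InCJC-pair⇒avoids (a≢j ∘ sym) (A-pairs j a j∈A a∈A (a≢j ∘ sym))

      escape-upper : UpperBound (A - j) escape
      escape-upper a a∈A-j =
        ⊑-trans (y≤x∨y j* a) (joinFrom-upper j* (∈-map⁺ (j* ∨_) (∈-members⁺ a∈A-j)))

      j*⊑escape : j* ⊑ escape
      j*⊑escape = joinFrom-base j* (map (j* ∨_) (members (A - j)))

    pairwiseCanonical⇒IrrJoinRep : ∀ {x} → IsJoin A x → IrrJoinRep x A
    pairwiseCanonical⇒IrrJoinRep A↦x = IrrJoinRep-byRemoval A↦x λ s s∈A (_ , A-s-least) →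
      let open Escape s∈A
      in proj₂ escape-avoids (⊑-trans (proj₁ A↦x s s∈A) (A-s-least escape escape-upper))

    pairwiseCanonical⇒IsCJR : ∀ {x} → IsJoin A x → IsCJR x A
    pairwiseCanonical⇒IsCJR {x} A↦x = pairwiseCanonical⇒IrrJoinRep A↦x , A-min
      where
      C     = proj₁ (proj₁ (sd x))
      C-cjr = proj₂ (proj₁ (sd x))

      A-min : ∀ K → IrrJoinRep x K → A ≼ K
      A-min K K-irr j j∈A with j ∈? C
      ... | yes j∈C = proj₂ C-cjr K K-irr j j∈C
      ... | no j∉C  = ⊥-elim (proj₂ escape-avoids (⊑-trans (proj₁ A↦x j j∈A) x⊑escape))
        where
        open Escape j∈A

        -- c lies below some a ∈ A, and when a = j we have c ≠ j because j ∉ C.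
        C-below-escape : UpperBound C escape
        C-below-escape c c∈C with proj₂ C-cjr A (pairwiseCanonical⇒IrrJoinRep A↦x) c c∈C
        ... | a , a∈A , c⊑a with a ≟ j
        ...   | no a≢j   = ⊑-trans c⊑a (escape-upper a (x∈p∧x≢y⇒x∈p-y a∈A a≢j))
        ...   | yes refl = ⊑-trans (⊏⇒⊑j* (c⊑a , λ { refl → j∉C c∈C })) j*⊑escape

        x⊑escape : x ⊑ escape
        x⊑escape = proj₂ (proj₁ (proj₁ C-cjr)) escape C-below-escape

module CanonicalComplex {n : ℕ} {_⊑_ : Rel (Fin n) 0ℓ} {_∨_ _∧_ : Op₂ (Fin n)}
  (isLattice : IsLattice _≡_ _⊑_ _∨_ _∧_) where

  open IsLattice isLattice using () renaming (trans to ⊑-trans)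
  open Canonical _⊑_
  open JoinRepresentations isLattice
  private module Meet = JoinRepresentations ∧-∨-isLattice

  IsFace-⊆ : ∀ J M J' M' → IsFace J M → J' ⊆ J → M' ⊆ M → IsFace J' M'
  IsFace-⊆ J M J' M' ((x , J-cjr) , (y , M-cmr) , _ , _ , J↦ , M↦ , ⋁J⊑⋀M) J'⊆J M'⊆M =
    (x' , IsCJR-⊆ J-cjr J'⊆J J'↦x') , (y' , Meet.IsCJR-⊆ M-cmr M'⊆M M'↦y') ,
    x' , y' , J'↦x' , M'↦y' , x'⊑y'
    where
    x'  = proj₁ (∃IsJoin x J')
    J'↦x' = proj₂ (∃IsJoin x J')
    y'  = proj₁ (Meet.∃IsJoin x M')
    M'↦y' = proj₂ (Meet.∃IsJoin x M')

    x'⊑y' : x' ⊑ y'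
    x'⊑y' = ⊑-trans (proj₂ J'↦x' _ λ j → proj₁ J↦ j ∘ J'⊆J)
                    (⊑-trans ⋁J⊑⋀M (proj₂ M'↦y' _ λ m → proj₁ M↦ m ∘ M'⊆M))

  IsFace-flag : Semidistributive → ∀ J M → InGround J M →
                (∀ J' M' → J' ⊆ J → M' ⊆ M → ∣ J' ∣ + ∣ M' ∣ ≤ 2 → IsFace J' M') →
                IsFace J M
  IsFace-flag sd J M (J-ji , M-mi) small-face =
    (x , J-cjr) , (y , M-cmr) , x , y , J↦x , M↦y , x⊑y
    where
    -- The empty face shows that the carrier is nonempty.
    e : Fin n
    e = proj₁ (proj₁ (small-face ∅ ∅ ⊥⊆ ⊥⊆ (∣∅∣+∣∅∣≤2 {n})))

    x = proj₁ (∃IsJoin e J)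
    J↦x = proj₂ (∃IsJoin e J)
    y = proj₁ (Meet.∃IsJoin e M)
    M↦y = proj₂ (Meet.∃IsJoin e M)

    J-cjr : IsCJR x J
    J-cjr = SemidistributiveLattice.pairwiseCanonical⇒IsCJR isLattice sd J-ji
      (λ j j' j∈J j'∈J _ → proj₁ (small-face (⁅ j ⁆ ∪ ⁅ j' ⁆) ∅ (⁅y⁆∪⁅z⁆⊆p j∈J j'∈J) ⊥⊆
                                            (∣p∣+∣∅∣≤2 (⁅ j ⁆ ∪ ⁅ j' ⁆) (∣⁅x⁆∪⁅y⁆∣≤2 j j'))))
      J↦x

    M-cmr : IsCMR y M
    M-cmr = SemidistributiveLattice.pairwiseCanonical⇒IsCJR ∧-∨-isLattice
      (Semidistributive⇒Semidistributiveᵒᵖ sd)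
      (λ m → IsMI⇒IsJIᵒᵖ ∘ M-mi m)
      (λ m m' m∈M m'∈M _ → proj₁ (proj₂ (small-face ∅ (⁅ m ⁆ ∪ ⁅ m' ⁆) ⊥⊆ (⁅y⁆∪⁅z⁆⊆p m∈M m'∈M)
                                                  (∣∅∣+∣p∣≤2 (⁅ m ⁆ ∪ ⁅ m' ⁆) (∣⁅x⁆∪⁅y⁆∣≤2 m m')))))
      M↦y

    j⊑m : ∀ {j m} → j ∈ J → m ∈ M → j ⊑ m
    j⊑m {j} {m} j∈J m∈M with small-face ⁅ j ⁆ ⁅ m ⁆ (⁅x⁆⊆p j∈J) (⁅x⁆⊆p m∈M) (∣⁅x⁆∣+∣⁅y⁆∣≤2 j m)
    ... | _ , _ , _ , _ , j↦ , m↦ , ⋁j⊑⋀m =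
      ⊑-trans (proj₁ j↦ j (x∈⁅x⁆ j)) (⊑-trans ⋁j⊑⋀m (proj₁ m↦ m (x∈⁅x⁆ m)))

    x⊑y : x ⊑ y
    x⊑y = proj₂ J↦x y λ j j∈J → proj₂ M↦y j λ m m∈M → j⊑m j∈J m∈M

proposition2p22 : ∀ {n : ℕ} {_⊑_ : Rel (Fin n) 0ℓ} {_∨_ _∧_ : Op₂ (Fin n)}
    → IsLattice _≡_ _⊑_ _∨_ _∧_
    → Canonical.Semidistributive _⊑_
    → Canonical.IsFlagComplex _⊑_
proposition2p22 isLattice sd = IsFace-⊆ , IsFace-flag sd
  where open CanonicalComplex isLattice
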